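{- Let $\mathbf{Q}$ be a QB-algebra, let $x\in Q$ be regular and $y\in Q$. Then: (1) if $y\in cl(x)$ and $y^{*}\in cl(x)$, then $x=x^{*}$; (2) if $y\in cl(x)$, then $y^{*}\in cl(x^{*})$; (3) if $x=x^{*}$ and $y\in cl(x)$, then $y^{*}\in cl(x)$.
   Context: A quasi-lattice is an algebra $\langle L;\vee,\wedge\rangle$ such that for all $x,y,z$: $\vee,\wedge$ are commutative and associative; $x\vee(x\wedge y)=x\vee x$ and $x\wedge(x\vee y)=x\wedge x$; $x\vee(y\vee y)=x\vee y$ and $x\wedge(y\wedge y)=x\wedge y$; $x\vee x=x\wedge x$; distributive if both distributive laws hold. A QB-algebra is an algebra $\langle Q;\vee,\wedge,{}^{*},0,1\rangle$ of type $\langle 2,2,1,0,0\rangle$ such that $\langle Q;\vee,\wedge\rangle$ is a distributive quasi-lattice and for all $x$: $x\vee 1=1$, $x\wedge 0=0$, $x\vee x^{*}=1$, $x\wedge x^{*}=0$, $(x\wedge x)^{*}=x^{*}\vee x^{*}$, $x^{**}=x$. An element $x$ is regular if $x\vee x=x$; the regular elements are closed under ${}^*$. For a regular element $x$, $cl(x)=\{y\in Q: y\vee y=x\vee x\}$ (the cloud of $x$, i.e. its class under the relation $\langle u,v\rangle\in\chi$ iff $u\vee u=v\vee v$). -}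

module Defs where

open import Level using (Level; suc)
open import Relation.Binary.PropositionalEquality using (_≡_)

record QBAlgebra (a : Level) : Set (suc a) where
  infixr 6 _∨_
  infixr 7 _∧_
  field
    Q   : Set a
    _∨_ : Q → Q → Q
    _∧_ : Q → Q → Q
    _*  : Q → Q
    𝟘   : Q
    𝟙   : Q
    ∨-comm  : ∀ x y → x ∨ y ≡ y ∨ x
    ∧-comm  : ∀ x y → x ∧ y ≡ y ∧ x
    ∨-assoc : ∀ x y z → (x ∨ y) ∨ z ≡ x ∨ (y ∨ z)
    ∧-assoc : ∀ x y z → (x ∧ y) ∧ z ≡ x ∧ (y ∧ z)
    ∨-absorb : ∀ x y → x ∨ (x ∧ y) ≡ x ∨ x
    ∧-absorb : ∀ x y → x ∧ (x ∨ y) ≡ x ∧ x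
    ∨-idem-right : ∀ x y → x ∨ (y ∨ y) ≡ x ∨ y
    ∧-idem-right : ∀ x y → x ∧ (y ∧ y) ≡ x ∧ y
    ∨∧-diag : ∀ x → x ∨ x ≡ x ∧ x
    ∧-distrib-∨ : ∀ x y z → x ∧ (y ∨ z) ≡ (x ∧ y) ∨ (x ∧ z)
    ∨-distrib-∧ : ∀ x y z → x ∨ (y ∧ z) ≡ (x ∨ y) ∧ (x ∨ z)
    ∨-one  : ∀ x → x ∨ 𝟙 ≡ 𝟙
    ∧-zero : ∀ x → x ∧ 𝟘 ≡ 𝟘
    ∨-compl : ∀ x → x ∨ (x *) ≡ 𝟙
    ∧-compl : ∀ x → x ∧ (x *) ≡ 𝟘
    *-diag  : ∀ x → (x ∧ x) * ≡ (x *) ∨ (x *)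
    *-invol : ∀ x → (x *) * ≡ x

  Regular : Q → Set a
  Regular x = x ∨ x ≡ x

  _∈cl_ : Q → Q → Set a
  y ∈cl x = y ∨ y ≡ x ∨ x

-- The map z ↦ z ∨ z is constant on clouds and commutes with the complement,
-- so complementation sends the cloud of x into the cloud of x*, and a cloud
-- contains only one regular element.
module Submission where

open import Defs
open import Level using (Level)
open import Data.Product using (_×_; _,_)
open import Relation.Binary.PropositionalEquality
  using (_≡_; sym; trans; cong; subst; module ≡-Reasoning)
open ≡-Reasoning

module _ {a : Level} (𝐐 : QBAlgebra a) where
  open QBAlgebra 𝐐

  *-∨-diag : ∀ z → (z ∨ z) * ≡ (z *) ∨ (z *)
  *-∨-diag z = trans (cong _* (∨∧-diag z)) (*-diag z)

  *-∈cl : ∀ {x y} → y ∈cl x → (y *) ∈cl (x *)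
  *-∈cl {x} {y} y∈clx = begin
    (y *) ∨ (y *)  ≡⟨ sym (*-∨-diag y) ⟩
    (y ∨ y) *      ≡⟨ cong _* y∈clx ⟩
    (x ∨ x) *      ≡⟨ *-∨-diag x ⟩
    (x *) ∨ (x *)  ∎

  ∈cl-unique : ∀ {x x′ y} → Regular x → Regular x′ → y ∈cl x → y ∈cl x′ → x ≡ x′
  ∈cl-unique {x} {x′} {y} reg reg′ y∈clx y∈clx′ = begin
    x        ≡⟨ sym reg ⟩
    x ∨ x    ≡⟨ sym y∈clx ⟩
    y ∨ y    ≡⟨ y∈clx′ ⟩
    x′ ∨ x′  ≡⟨ reg′ ⟩
    x′       ∎

  *-regular : ∀ {x} → Regular x → Regular (x *)
  *-regular {x} reg = trans (sym (*-∨-diag x)) (cong _* reg)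

lemma3p3 : ∀ {a : Level} (𝐐 : QBAlgebra a) → let open QBAlgebra 𝐐 in
    ∀ (x y : Q) → Regular x →
      ((y ∈cl x → (y *) ∈cl x → x ≡ x *)
      × (y ∈cl x → (y *) ∈cl (x *))
      × (x ≡ x * → y ∈cl x → (y *) ∈cl x))
lemma3p3 𝐐 x y reg =
    (λ y∈clx y*∈clx → ∈cl-unique 𝐐 reg (*-regular 𝐐 reg) y*∈clx (*-∈cl 𝐐 y∈clx))
  , *-∈cl 𝐐
  , λ x≡x* y∈clx → subst (λ w → (y *) ∈cl w) (sym x≡x*) (*-∈cl 𝐐 y∈clx)
  where open QBAlgebra 𝐐
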